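{- Let $m\ge1$ and $\alpha,\beta\in\mathsf{FORM}_m$. Then $\alpha\models_\Diamond\beta$ iff the formula $$(\beta\sqcup\nabla\neg\alpha)\wedge(\beta\sqcup\neg\nabla\alpha)\wedge\neg(\beta\sqcup\nabla\neg\alpha)\wedge\neg(\beta\sqcup\neg\nabla\alpha)$$ is a tautology. Consequently, $\hat\alpha=\hat\beta$ iff the formula $$(\beta\sqcup\nabla\neg\alpha)\wedge(\beta\sqcup\neg\nabla\alpha)\wedge\neg(\beta\sqcup\nabla\neg\alpha)\wedge\neg(\beta\sqcup\neg\nabla\alpha)\wedge(\alpha\sqcup\nabla\neg\beta)\wedge(\alpha\sqcup\neg\nabla\beta)\wedge\neg(\alpha\sqcup\nabla\neg\beta)\wedge\neg(\alpha\sqcup\neg\nabla\beta)$$ is a tautology.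
   Context: Let $\mathfrak Z=\{0,1/2,1\}$, with the following binary operations. - $x\wedge y=\min(x,y)$. - $x\sqcup y=x$ if $x=y$, and $x\sqcup y=1/2$ otherwise. - $\partial(x,y)=1/2$ if $y=1/2$. If $y\in\{0,1\}$, then $\partial(x,y)=y$ when $x=y$, and $\partial(x,y)=1-y$ when $x\ne y$. $\mathsf{FORM}_m$ is the set of formulas in variables $X_1,\dots,X_m$ and constants $0,1/2$ built with the connectives $\sqcup,\partial,\wedge$. Each formula gives $\hat\phi\colon\mathfrak Z^m\to\mathfrak Z$. Abbreviations: $\neg\phi=\partial(1/2,\phi)$ and $\nabla\phi=\partial(\phi,0)$. A formula is a tautology iff its value is $1/2$ under every valuation. $\alpha\models_\Diamond\beta$ means: for every $v\in\mathfrak Z^m$, $\hat\alpha(v)\sqcup\hat\beta(v)=\hat\beta(v)$ or $\hat\beta(v)=1/2$. -}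

module Defs where

open import Data.Nat using (ℕ)
open import Data.Fin using (Fin)
open import Data.Product using (_×_)
open import Data.Sum using (_⊎_)
open import Relation.Binary.PropositionalEquality using (_≡_)

-- The three-element set 𝔷 = {0, 1/2, 1}
data Z : Set where
  z0 zh z1 : Z

_∧ᶻ_ : Z → Z → Z
z0 ∧ᶻ y  = z0
zh ∧ᶻ z0 = z0
zh ∧ᶻ zh = zh
zh ∧ᶻ z1 = zh
z1 ∧ᶻ y  = y

_⊔ᶻ_ : Z → Z → Z
z0 ⊔ᶻ z0 = z0
z1 ⊔ᶻ z1 = z1
zh ⊔ᶻ zh = zh
_  ⊔ᶻ _  = zh

flip01 : Z → Z
flip01 z0 = z1
flip01 z1 = z0
flip01 zh = zh

∂ᶻ : Z → Z → Z
∂ᶻ x  zh = zh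
∂ᶻ z0 z0 = z0
∂ᶻ zh z0 = z1
∂ᶻ z1 z0 = z1
∂ᶻ z1 z1 = z1
∂ᶻ z0 z1 = z0
∂ᶻ zh z1 = z0

data Form (m : ℕ) : Set where
  var   : Fin m → Form m
  cst0  : Form m
  csth  : Form m
  _⊔_   : Form m → Form m → Form m
  ∂     : Form m → Form m → Form m
  _∧_   : Form m → Form m → Form m

infixl 6 _∧_
infixl 7 _⊔_

⟦_⟧ : ∀ {m} → Form m → (Fin m → Z) → Z
⟦ var i ⟧   v = v i
⟦ cst0 ⟧    v = z0
⟦ csth ⟧    v = zh
⟦ φ ⊔ ψ ⟧   v = ⟦ φ ⟧ v ⊔ᶻ ⟦ ψ ⟧ v
⟦ ∂ φ ψ ⟧   v = ∂ᶻ (⟦ φ ⟧ v) (⟦ ψ ⟧ v)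
⟦ φ ∧ ψ ⟧   v = ⟦ φ ⟧ v ∧ᶻ ⟦ ψ ⟧ v

¬ᶠ : ∀ {m} → Form m → Form m
¬ᶠ φ = ∂ csth φ

∇ : ∀ {m} → Form m → Form m
∇ φ = ∂ φ cst0

Tautology : ∀ {m} → Form m → Set
Tautology {m} φ = (v : Fin m → Z) → ⟦ φ ⟧ v ≡ zh

_⊨◇_ : ∀ {m} → Form m → Form m → Set
_⊨◇_ {m} α β = (v : Fin m → Z) →
  ((⟦ α ⟧ v ⊔ᶻ ⟦ β ⟧ v) ≡ ⟦ β ⟧ v) ⊎ (⟦ β ⟧ v ≡ zh)

entailForm : ∀ {m} → Form m → Form m → Form m
entailForm α β =
  (β ⊔ ∇ (¬ᶠ α)) ∧ (β ⊔ ¬ᶠ (∇ α)) ∧ ¬ᶠ (β ⊔ ∇ (¬ᶠ α)) ∧ ¬ᶠ (β ⊔ ¬ᶠ (∇ α))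

equivForm : ∀ {m} → Form m → Form m → Form m
equivForm α β =
  (β ⊔ ∇ (¬ᶠ α)) ∧ (β ⊔ ¬ᶠ (∇ α)) ∧ ¬ᶠ (β ⊔ ∇ (¬ᶠ α)) ∧ ¬ᶠ (β ⊔ ¬ᶠ (∇ α))
  ∧ (α ⊔ ∇ (¬ᶠ β)) ∧ (α ⊔ ¬ᶠ (∇ β)) ∧ ¬ᶠ (α ⊔ ∇ (¬ᶠ β)) ∧ ¬ᶠ (α ⊔ ¬ᶠ (∇ β))

-- Both formulas are evaluated pointwise, so everything reduces to identities between
-- truth functions on 𝔷. Writing a, b for the values of α, β and c = b ⊔ ∇¬a, d = b ⊔ ¬∇a,
-- the formula c ∧ d ∧ ¬c ∧ ¬d takes the value 1/2 exactly when c = d = 1/2, because a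
-- value and its negation are both ≥ 1/2 only at 1/2. Since ∇¬a = 0 only at a = 1 and
-- ¬∇a = 1 only at a = 0, the two conditions c = d = 1/2 say exactly that b = 1/2 or b = a,
-- which is α ⊨◇ β at that point. The eight-conjunct formula is the meet of the entailment
-- formulas in both directions, and the pointwise relation "b = a or b = 1/2" is antisymmetric.
module Submission where

open import Defs
open import Data.Nat using (ℕ; _≥_)
open import Data.Fin using (Fin)
open import Data.Product using (_×_; _,_)
open import Data.Product.Function.NonDependent.Propositional using (_×-⇔_)
open import Data.Empty using (⊥-elim)
open import Data.Sum using (_⊎_; inj₁; inj₂)
open import Function.Bundles using (_⇔_; mk⇔; Equivalence)
open import Function.Properties.Equivalence using () renaming (trans to ⇔-trans; sym to ⇔-sym)
open import Relation.Binary.PropositionalEquality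
  using (_≡_; _≢_; refl; cong; module ≡-Reasoning)

¬ᶻ : Z → Z
¬ᶻ x = ∂ᶻ zh x

∇ᶻ : Z → Z
∇ᶻ x = ∂ᶻ x z0

_≼◇_ : Z → Z → Set
a ≼◇ b = ((a ⊔ᶻ b) ≡ b) ⊎ (b ≡ zh)

-- ⟦ entailForm α β ⟧ v computes to entailᶻ (⟦ α ⟧ v) (⟦ β ⟧ v).
entailᶻ : Z → Z → Z
entailᶻ a b = ((c ∧ᶻ d) ∧ᶻ ¬ᶻ c) ∧ᶻ ¬ᶻ d
  where
  c d : Z
  c = b ⊔ᶻ ∇ᶻ (¬ᶻ a)
  d = b ⊔ᶻ ¬ᶻ (∇ᶻ a)

∀-⇔ : {A : Set} {P Q : A → Set} → (∀ x → P x ⇔ Q x) → ((∀ x → P x) ⇔ (∀ x → Q x))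
∀-⇔ P⇔Q = mk⇔ (λ p x → Equivalence.to (P⇔Q x) (p x))
              (λ q x → Equivalence.from (P⇔Q x) (q x))

∧ᶻ-assoc : ∀ x y z → (x ∧ᶻ y) ∧ᶻ z ≡ x ∧ᶻ (y ∧ᶻ z)
∧ᶻ-assoc z0 y  z  = refl
∧ᶻ-assoc z1 y  z  = refl
∧ᶻ-assoc zh z0 z  = refl
∧ᶻ-assoc zh zh z0 = refl
∧ᶻ-assoc zh zh zh = refl
∧ᶻ-assoc zh zh z1 = refl
∧ᶻ-assoc zh z1 z0 = refl
∧ᶻ-assoc zh z1 zh = refl
∧ᶻ-assoc zh z1 z1 = refl

∧ᶻ-≡-zh⇔ : ∀ {x y} → x ≢ z1 → y ≢ z1 → (x ∧ᶻ y ≡ zh) ⇔ (x ≡ zh × y ≡ zh)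
∧ᶻ-≡-zh⇔ {x} {y} x≢1 y≢1 = mk⇔ (to x y x≢1 y≢1) λ { (refl , refl) → refl }
  where
  to : ∀ x y → x ≢ z1 → y ≢ z1 → x ∧ᶻ y ≡ zh → x ≡ zh × y ≡ zh
  to zh zh _   _   _  = refl , refl
  to z0 _  _   _   ()
  to zh z0 _   _   ()
  to zh z1 _   y≢1 _  = ⊥-elim (y≢1 refl)
  to z1 _  x≢1 _   _  = ⊥-elim (x≢1 refl)

∧¬∧¬-≡-zh⇔ : ∀ c d → (((c ∧ᶻ d) ∧ᶻ ¬ᶻ c) ∧ᶻ ¬ᶻ d ≡ zh) ⇔ (c ≡ zh × d ≡ zh)
∧¬∧¬-≡-zh⇔ c d = mk⇔ (to c d) λ { (refl , refl) → refl }
  where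
  to : ∀ c d → ((c ∧ᶻ d) ∧ᶻ ¬ᶻ c) ∧ᶻ ¬ᶻ d ≡ zh → c ≡ zh × d ≡ zh
  to zh zh _ = refl , refl
  to z0 _  ()
  to z1 z0 ()
  to z1 zh ()
  to z1 z1 ()
  to zh z0 ()
  to zh z1 ()

⊔∇¬-⊔¬∇-≡-zh⇔≼◇ : ∀ a b →
  ((b ⊔ᶻ ∇ᶻ (¬ᶻ a) ≡ zh) × (b ⊔ᶻ ¬ᶻ (∇ᶻ a) ≡ zh)) ⇔ (a ≼◇ b)
⊔∇¬-⊔¬∇-≡-zh⇔≼◇ a b = mk⇔ (to a b) (from a b)
  where
  to : ∀ a b → (b ⊔ᶻ ∇ᶻ (¬ᶻ a) ≡ zh) × (b ⊔ᶻ ¬ᶻ (∇ᶻ a) ≡ zh) → a ≼◇ b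
  to z0 z0 _ = inj₁ refl
  to z1 z1 _ = inj₁ refl
  to z0 zh _ = inj₂ refl
  to zh zh _ = inj₂ refl
  to z1 zh _ = inj₂ refl
  to z0 z1 (() , _)
  to zh z0 (_ , ())
  to zh z1 (() , _)
  to z1 z0 (() , _)

  from : ∀ a b → a ≼◇ b → (b ⊔ᶻ ∇ᶻ (¬ᶻ a) ≡ zh) × (b ⊔ᶻ ¬ᶻ (∇ᶻ a) ≡ zh)
  from z0 z0 _ = refl , refl
  from z1 z1 _ = refl , refl
  from z0 zh _ = refl , refl
  from zh zh _ = refl , refl
  from z1 zh _ = refl , refl
  from z0 z1 (inj₁ ())
  from z0 z1 (inj₂ ())
  from zh z0 (inj₁ ())
  from zh z0 (inj₂ ())
  from zh z1 (inj₁ ())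
  from zh z1 (inj₂ ())
  from z1 z0 (inj₁ ())
  from z1 z0 (inj₂ ())

entailᶻ-≡-zh⇔≼◇ : ∀ a b → (entailᶻ a b ≡ zh) ⇔ (a ≼◇ b)
entailᶻ-≡-zh⇔≼◇ a b =
  ⇔-trans (∧¬∧¬-≡-zh⇔ (b ⊔ᶻ ∇ᶻ (¬ᶻ a)) (b ⊔ᶻ ¬ᶻ (∇ᶻ a))) (⊔∇¬-⊔¬∇-≡-zh⇔≼◇ a b)

-- It contains a conjunct c ∧ ¬c, and min(c, ¬c) ≤ 1/2.
entailᶻ-≢-z1 : ∀ a b → entailᶻ a b ≢ z1
entailᶻ-≢-z1 z0 z0 ()
entailᶻ-≢-z1 z0 zh ()
entailᶻ-≢-z1 z0 z1 ()
entailᶻ-≢-z1 zh z0 ()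
entailᶻ-≢-z1 zh zh ()
entailᶻ-≢-z1 zh z1 ()
entailᶻ-≢-z1 z1 z0 ()
entailᶻ-≢-z1 z1 zh ()
entailᶻ-≢-z1 z1 z1 ()

≡⇔≼◇×≼◇ : ∀ a b → (a ≡ b) ⇔ (a ≼◇ b × b ≼◇ a)
≡⇔≼◇×≼◇ a b = mk⇔ (λ { refl → ≼◇-refl a , ≼◇-refl a }) (from a b)
  where
  ≼◇-refl : ∀ a → a ≼◇ a
  ≼◇-refl z0 = inj₁ refl
  ≼◇-refl zh = inj₁ refl
  ≼◇-refl z1 = inj₁ refl

  from : ∀ a b → a ≼◇ b × b ≼◇ a → a ≡ b
  from z0 z0 _ = refl
  from zh zh _ = refl
  from z1 z1 _ = refl
  from zh z0 (inj₁ () , _)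
  from zh z0 (inj₂ () , _)
  from zh z1 (inj₁ () , _)
  from zh z1 (inj₂ () , _)
  from z0 zh (_ , inj₁ ())
  from z0 zh (_ , inj₂ ())
  from z1 zh (_ , inj₁ ())
  from z1 zh (_ , inj₂ ())
  from z0 z1 (inj₁ () , _)
  from z0 z1 (inj₂ () , _)
  from z1 z0 (inj₁ () , _)
  from z1 z0 (inj₂ () , _)

⟦equivForm⟧ : ∀ {m} (α β : Form m) (v : Fin m → Z) →
  ⟦ equivForm α β ⟧ v ≡ ⟦ entailForm α β ⟧ v ∧ᶻ ⟦ entailForm β α ⟧ v
⟦equivForm⟧ α β v = begin
  (((e ∧ᶻ c) ∧ᶻ d) ∧ᶻ ¬ᶻ c) ∧ᶻ ¬ᶻ d   ≡⟨ cong (λ t → (t ∧ᶻ ¬ᶻ c) ∧ᶻ ¬ᶻ d) (∧ᶻ-assoc e c d) ⟩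
  ((e ∧ᶻ (c ∧ᶻ d)) ∧ᶻ ¬ᶻ c) ∧ᶻ ¬ᶻ d   ≡⟨ cong (_∧ᶻ ¬ᶻ d) (∧ᶻ-assoc e (c ∧ᶻ d) (¬ᶻ c)) ⟩
  (e ∧ᶻ ((c ∧ᶻ d) ∧ᶻ ¬ᶻ c)) ∧ᶻ ¬ᶻ d   ≡⟨ ∧ᶻ-assoc e ((c ∧ᶻ d) ∧ᶻ ¬ᶻ c) (¬ᶻ d) ⟩
  e ∧ᶻ (((c ∧ᶻ d) ∧ᶻ ¬ᶻ c) ∧ᶻ ¬ᶻ d)   ∎
  where
  open ≡-Reasoning
  a b e c d : Z
  a = ⟦ α ⟧ v
  b = ⟦ β ⟧ v
  e = entailᶻ a b
  c = a ⊔ᶻ ∇ᶻ (¬ᶻ b)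
  d = a ⊔ᶻ ¬ᶻ (∇ᶻ b)

∧-entailᶻ-≡-zh⇔≡ : ∀ a b → (entailᶻ a b ∧ᶻ entailᶻ b a ≡ zh) ⇔ (a ≡ b)
∧-entailᶻ-≡-zh⇔≡ a b =
  ⇔-trans (∧ᶻ-≡-zh⇔ (entailᶻ-≢-z1 a b) (entailᶻ-≢-z1 b a))
  (⇔-trans (entailᶻ-≡-zh⇔≼◇ a b ×-⇔ entailᶻ-≡-zh⇔≼◇ b a)
           (⇔-sym (≡⇔≼◇×≼◇ a b)))

⟦equivForm⟧-≡-zh⇔≡ : ∀ {m} (α β : Form m) (v : Fin m → Z) →
  (⟦ equivForm α β ⟧ v ≡ zh) ⇔ (⟦ α ⟧ v ≡ ⟦ β ⟧ v)
⟦equivForm⟧-≡-zh⇔≡ α β v rewrite ⟦equivForm⟧ α β v = ∧-entailᶻ-≡-zh⇔≡ (⟦ α ⟧ v) (⟦ β ⟧ v)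

proposition5p10 : (m : ℕ) → m ≥ 1 → (α β : Form m) →
    ((α ⊨◇ β) ⇔ Tautology (entailForm α β))
    × (((v : Fin m → Z) → ⟦ α ⟧ v ≡ ⟦ β ⟧ v) ⇔ Tautology (equivForm α β))
proposition5p10 m _ α β =
    ∀-⇔ (λ v → ⇔-sym (entailᶻ-≡-zh⇔≼◇ (⟦ α ⟧ v) (⟦ β ⟧ v)))
  , ∀-⇔ (λ v → ⇔-sym (⟦equivForm⟧-≡-zh⇔≡ α β v))
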